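{- Let $s\ge2$, $2\le i\le s$, and let $\mu=(\mu_1,\dots,\mu_s)\vdash n$ with $\mu_{i-1}>\mu_i$. Then $$f(\mu^{\uparrow i})-f(\mu)=(2\mu_i+s-i+1)f(\mu^{\uparrow i}-\hat{1})-(2\mu_i+s-i)f(\mu-\hat{1}).$$
   Context: Partitions are non-increasing sequences of positive integers; $\lambda\vdash n$ means the parts sum to $n$. For $\lambda=(\lambda_1,\dots,\lambda_r)$: $\lambda\setminus\lambda_r:=(\lambda_1,\dots,\lambda_{r-1})$; for $1\le k\le\lambda_r$, $\lambda-\hat{k}:=(\lambda_1-k,\dots,\lambda_r-k)$; zero parts are deleted and the all-zero sequence is identified with $(0)$. For a partition $\mu$ of length $s$ with $\mu_{i-1}>\mu_i$, $\mu^{\uparrow i}$ is the partition obtained by replacing $\mu_i$ by $\mu_i+1$. Define $d_0=1$, $d_1=0$, $d_n=2(n-1)(d_{n-1}+d_{n-2})$ for $n\ge2$. Define $f$ on partitions recursively: $f((0))=1$; $f((n))=d_n$ for $n\ge1$; and for $\lambda=(\lambda_1,\dots,\lambda_r)$ with $r\ge2$, $f(\lambda)=f(\lambda\setminus\lambda_r)+\sum_{k=1}^{\lambda_r}\binom{\lambda_r}{k}(2k-1)!!\,f(\lambda\setminus\lambda_r-\hat{k})$. -}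

module Defs where

open import Data.Nat using (ℕ; zero; suc; _+_; _*_; _∸_; _≥_; _<_; _>_)
open import Data.Nat.Combinatorics using (_C_)
open import Data.List using (List; []; _∷_; map; filter; length; upTo)
open import Data.Nat.ListAction using (sum)
open import Data.List.Relation.Unary.All using (All)
open import Data.List.Relation.Unary.Linked using (Linked)
open import Relation.Nullary using (¬_)
open import Relation.Binary.PropositionalEquality using (_≡_)
open import Data.Nat using (_≟_)
open import Relation.Nullary.Decidable using (¬?)

-- Partitions are represented as lists of naturals (largest part first).
-- The partition (0) is represented by the empty list [] (all zero parts deleted).
IsPartition : List ℕ → Set
IsPartition μ = All (λ x → x > 0) μ × Linked _≥_ μ
  where open import Data.Product using (_×_)

_⊢_ : List ℕ → ℕ → Set
μ ⊢ n = IsPartition μ × (sum μ ≡ n)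
  where open import Data.Product using (_×_)

d : ℕ → ℕ
d zero = 1
d (suc zero) = 0
d (suc (suc n)) = 2 * suc n * (d (suc n) + d n)

-- oddDF k = (2k-1)!!  (with (-1)!! = 1)
oddDF : ℕ → ℕ
oddDF zero = 1
oddDF (suc k) = suc (2 * k) * oddDF k

minusHat : ℕ → List ℕ → List ℕ
minusHat k μ = filter (λ x → ¬? (x ≟ 0)) (map (λ x → x ∸ k) μ)

lastOf : ℕ → List ℕ → ℕ
lastOf x [] = x
lastOf x (y ∷ ys) = lastOf y ys

initOf : ℕ → List ℕ → List ℕ
initOf x [] = []
initOf x (y ∷ ys) = x ∷ initOf y ys

-- f, with fuel (the fuel length λ always suffices)
fAux : ℕ → List ℕ → ℕ
fAux _ [] = 1
fAux _ (n ∷ []) = d n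
fAux zero (_ ∷ _ ∷ _) = 0
fAux (suc fuel) (x ∷ y ∷ ys) =
  fAux fuel λr
  + sum (map (λ j → (r C suc j) * oddDF (suc j) * fAux fuel (minusHat (suc j) λr)) (upTo r))
  where
    r : ℕ
    r = lastOf y ys
    λr : List ℕ
    λr = initOf x (y ∷ ys)

f : List ℕ → ℕ
f μ = fAux (length μ) μ

-- 1-indexed part μ_j (0 if out of range)
part : List ℕ → ℕ → ℕ
part [] _ = 0
part (x ∷ xs) zero = 0
part (x ∷ xs) (suc zero) = x
part (x ∷ xs) (suc (suc j)) = part xs (suc j)

-- μ^{↑i} : replace μ_i by μ_i + 1 (1-indexed)
bump : ℕ → List ℕ → List ℕ
bump _ [] = []
bump zero (x ∷ xs) = x ∷ xs
bump (suc zero) (x ∷ xs) = suc x ∷ xs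
bump (suc (suc i)) (x ∷ xs) = x ∷ bump (suc i) xs

-- Write a partition by its gaps read upwards from the smallest part,
-- L = (μ_s , μ_{s-1} - μ_s , … , μ_1 - μ_2).  In these coordinates the recursion for f
-- is a binomial transform in the first gap, F (x ∷ c ∷ L) = Σ_k C(x,k) (2k-1)!! F ((x-k+c) ∷ L),
-- the move μ ↦ μ^{↑i} shifts one unit from gap p+1 to gap p (where p = s - i), and
-- λ ↦ λ - 1̂ removes one unit from the first gap.  The proposition then says that the two
-- sequences t ↦ F (inc_p (t ∷ M)) and t ↦ F (t ∷ inc_p M) satisfy the three-term relation
-- X(t+1) - (2t+α+1) X(t) = Y(t+1) - (2t+α) Y(t) with α = 2 (M_0 + … + M_{p-1}) + 2 + p.
-- This goes by induction on p: by Pascal's rule the binomial transform turns a pair related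
-- with α into a pair related with α+1, and the base case p = 0 comes down to the absorption
-- identity (n+1) C(n,k) + k C(n+1,k) = (n+1) C(n+1,k).
module Submission where

open import Defs
open import Data.Nat using (ℕ; _≤_; _<_; _+_; _*_; _∸_)
open import Data.List using (List; length)
open import Data.Integer using (ℤ; +_; _-_) renaming (_*_ to _*ℤ_)
open import Relation.Binary.PropositionalEquality using (_≡_)

open import Data.Nat using (zero; suc; _>_; _≥_; z≤n; s≤s; s≤s⁻¹; _≟_)
open import Data.Nat.Properties
open import Data.Nat.Combinatorics using (_C_; k>n⇒nCk≡0; nC1≡n; nCk+nC[k+1]≡[n+1]C[k+1])
open import Data.Nat.Tactic.RingSolver using (solve-∀)
open import Data.Nat.ListAction using (sum)
open import Data.Nat.ListAction.Properties using (sum-++)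
open import Data.Integer using (_⊖_)
open import Data.Integer.Properties using (+-cancelˡ-⊖; [+m]-[+n]≡m⊖n; pos-*)
open import Data.Fin using (toℕ)
open import Data.Fin.Properties using (toℕ<n)
open import Data.Vec.Functional using (Vector)
open import Data.List using ([]; _∷_; _∷ʳ_; _++_; map; applyUpTo; upTo; filter; take)
open import Data.List.Properties using (map-++; map-∘; map-cong; map-id; filter-++; filter-all; length-map; length-++; ++-identityʳ)
open import Data.List.Relation.Unary.All using (All; []; _∷_; universal)
open import Data.List.Relation.Unary.All.Properties using (map⁺; ∷ʳ⁺; ++⁻ʳ)
open import Data.List.Relation.Unary.Linked using (Linked; []; [-]; _∷_)
open import Data.Product using (_,_; ∃)
open import Algebra.Properties.Semiring.Sum +-*-semiring using (sum-syntax; sum-cong-≗; ∑-distrib-+; *-distribˡ-sum)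
open import Algebra.Properties.CommutativeSemigroup +-commutativeSemigroup using (x∙yz≈xz∙y)
open import Relation.Nullary using (¬_; Dec)
open import Relation.Nullary.Decidable using (¬?)
open import Function using (_∘_)
open import Relation.Binary.PropositionalEquality using (refl; sym; trans; cong; cong₂; subst; subst₂; module ≡-Reasoning)
open ≡-Reasoning

-- Finite sums and binomial coefficients

sum-cong-< : ∀ n {g h : ℕ → ℕ} → (∀ k → k < n → g k ≡ h k) →
             ∑[ k < n ] g (toℕ k) ≡ ∑[ k < n ] h (toℕ k)
sum-cong-< n g≡h = sum-cong-≗ (λ k → g≡h (toℕ k) (toℕ<n k))

sum-init-zero : ∀ n (g : ℕ → ℕ) → g n ≡ 0 → ∑[ k < suc n ] g (toℕ k) ≡ ∑[ k < n ] g (toℕ k)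
sum-init-zero zero    g g0≡0 = cong (_+ 0) g0≡0
sum-init-zero (suc n) g gn≡0 = cong (_+_ (g 0)) (sum-init-zero n (g ∘ suc) gn≡0)

sum-map-applyUpTo : ∀ n (g h : ℕ → ℕ) → sum (map g (applyUpTo h n)) ≡ ∑[ k < n ] g (h (toℕ k))
sum-map-applyUpTo zero    g h = refl
sum-map-applyUpTo (suc n) g h = cong (_+_ (g (h 0))) (sum-map-applyUpTo n g (h ∘ suc))

sum-map-upTo : ∀ n (g : ℕ → ℕ) → sum (map g (upTo n)) ≡ ∑[ k < n ] g (toℕ k)
sum-map-upTo n g = sum-map-applyUpTo n g (λ k → k)

∑-linear : ∀ {n} c (F G H : Vector ℕ n) →
  ∑[ k < n ] F k + ∑[ k < n ] G k + c * ∑[ k < n ] H k ≡ ∑[ k < n ] (F k + G k + c * H k)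
∑-linear c F G H = begin
  ∑[ k < _ ] F k + ∑[ k < _ ] G k + c * ∑[ k < _ ] H k
    ≡⟨ cong₂ _+_ (sym (∑-distrib-+ F G)) (*-distribˡ-sum c H) ⟩
  ∑[ k < _ ] (F k + G k) + ∑[ k < _ ] (c * H k)
    ≡⟨ ∑-distrib-+ (λ k → F k + G k) (λ k → c * H k) ⟨
  ∑[ k < _ ] (F k + G k + c * H k) ∎

sum-pascal : ∀ a n (u : ℕ → ℕ) →
  ∑[ k < suc n ] ((suc a C toℕ k) * u (toℕ k))
    ≡ ∑[ k < suc n ] ((a C toℕ k) * u (toℕ k)) + ∑[ k < n ] ((a C toℕ k) * u (suc (toℕ k)))
sum-pascal a n u = begin
  u 0 + 0 + ∑[ k < n ] ((suc a C suc (toℕ k)) * u (suc (toℕ k)))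
    ≡⟨ cong (_+_ (u 0 + 0)) (sum-cong-≗ {n} λ k → cong (_* u (suc (toℕ k))) (nCk+nC[k+1]≡[n+1]C[k+1] a (toℕ k))) ⟨
  u 0 + 0 + ∑[ k < n ] ((a C toℕ k + a C suc (toℕ k)) * u (suc (toℕ k)))
    ≡⟨ cong (_+_ (u 0 + 0)) (sum-cong-≗ {n} λ k → *-distribʳ-+ (u (suc (toℕ k))) (a C toℕ k) (a C suc (toℕ k))) ⟩
  u 0 + 0 + ∑[ k < n ] ((a C toℕ k) * u (suc (toℕ k)) + (a C suc (toℕ k)) * u (suc (toℕ k)))
    ≡⟨ cong (_+_ (u 0 + 0)) (∑-distrib-+ {n} (λ k → (a C toℕ k) * u (suc (toℕ k))) (λ k → (a C suc (toℕ k)) * u (suc (toℕ k)))) ⟩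
  u 0 + 0 + (∑[ k < n ] ((a C toℕ k) * u (suc (toℕ k))) + ∑[ k < n ] ((a C suc (toℕ k)) * u (suc (toℕ k))))
    ≡⟨ x∙yz≈xz∙y (u 0 + 0) _ _ ⟩
  u 0 + 0 + ∑[ k < n ] ((a C suc (toℕ k)) * u (suc (toℕ k))) + ∑[ k < n ] ((a C toℕ k) * u (suc (toℕ k))) ∎

[1+k]*[1+n]C[1+k]≡[1+n]*nCk : ∀ n k → suc k * (suc n C suc k) ≡ suc n * (n C k)
[1+k]*[1+n]C[1+k]≡[1+n]*nCk zero    zero    = refl
[1+k]*[1+n]C[1+k]≡[1+n]*nCk zero    (suc k) = begin
  suc (suc k) * (1 C suc (suc k)) ≡⟨ cong (suc (suc k) *_) (k>n⇒nCk≡0 {1} {suc (suc k)} (s≤s (s≤s z≤n))) ⟩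
  suc (suc k) * 0                 ≡⟨ *-zeroʳ (suc (suc k)) ⟩
  0                               ≡⟨ cong (1 *_) (k>n⇒nCk≡0 {0} {suc k} (s≤s z≤n)) ⟨
  1 * (0 C suc k)                 ∎
[1+k]*[1+n]C[1+k]≡[1+n]*nCk (suc n) zero    = begin
  1 * (suc (suc n) C 1)     ≡⟨ *-identityˡ _ ⟩
  suc (suc n) C 1           ≡⟨ nC1≡n (suc (suc n)) ⟩
  suc (suc n)               ≡⟨ *-identityʳ (suc (suc n)) ⟨
  suc (suc n) * (suc n C 0) ∎
[1+k]*[1+n]C[1+k]≡[1+n]*nCk (suc n) (suc k) = begin
  suc (suc k) * (suc (suc n) C suc (suc k))
    ≡⟨ cong (suc (suc k) *_) (nCk+nC[k+1]≡[n+1]C[k+1] (suc n) (suc k)) ⟨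
  suc (suc k) * (suc n C suc k + suc n C suc (suc k))
    ≡⟨ distribute (suc n C suc k) (suc n C suc (suc k)) k ⟩
  suc n C suc k + suc k * (suc n C suc k) + suc (suc k) * (suc n C suc (suc k))
    ≡⟨ cong₂ (λ a b → suc n C suc k + a + b) ([1+k]*[1+n]C[1+k]≡[1+n]*nCk n k) ([1+k]*[1+n]C[1+k]≡[1+n]*nCk n (suc k)) ⟩
  suc n C suc k + suc n * (n C k) + suc n * (n C suc k)
    ≡⟨ trans (cong (_+_ (suc n C suc k)) (*-distribˡ-+ (suc n) (n C k) (n C suc k)))
             (sym (+-assoc (suc n C suc k) (suc n * (n C k)) (suc n * (n C suc k)))) ⟨
  suc n C suc k + suc n * (n C k + n C suc k)
    ≡⟨ cong (λ c → suc n C suc k + suc n * c) (nCk+nC[k+1]≡[n+1]C[k+1] n k) ⟩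
  suc (suc n) * (suc n C suc k) ∎
  where
  distribute : ∀ a b k → suc (suc k) * (a + b) ≡ a + suc k * a + suc (suc k) * b
  distribute = solve-∀

[1+n]*nCk+k*[1+n]Ck≡[1+n]*[1+n]Ck : ∀ n k → suc n * (n C k) + k * (suc n C k) ≡ suc n * (suc n C k)
[1+n]*nCk+k*[1+n]Ck≡[1+n]*[1+n]Ck n zero    = +-identityʳ _
[1+n]*nCk+k*[1+n]Ck≡[1+n]*[1+n]Ck n (suc k) = begin
  suc n * (n C suc k) + suc k * (suc n C suc k)
    ≡⟨ cong (_+_ (suc n * (n C suc k))) ([1+k]*[1+n]C[1+k]≡[1+n]*nCk n k) ⟩
  suc n * (n C suc k) + suc n * (n C k)
    ≡⟨ *-distribˡ-+ (suc n) (n C suc k) (n C k) ⟨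
  suc n * (n C suc k + n C k)
    ≡⟨ cong (suc n *_) (trans (+-comm (n C suc k) (n C k)) (nCk+nC[k+1]≡[n+1]C[k+1] n k)) ⟩
  suc n * (suc n C suc k) ∎

-- The double-factorial binomial transform

binomDF : ℕ → (ℕ → ℕ) → ℕ
binomDF a h = ∑[ k < suc a ] ((a C toℕ k) * (oddDF (toℕ k) * h (a ∸ toℕ k)))

binomDF-cong : ∀ a {h h′ : ℕ → ℕ} → (∀ t → h t ≡ h′ t) → binomDF a h ≡ binomDF a h′
binomDF-cong a h≗h′ = sum-cong-≗ {suc a} λ k → cong (λ z → (a C toℕ k) * (oddDF (toℕ k) * z)) (h≗h′ (a ∸ toℕ k))

binomDF-∘suc : ∀ a (h : ℕ → ℕ) →
  ∑[ k < suc (suc a) ] ((a C toℕ k) * (oddDF (toℕ k) * h (suc a ∸ toℕ k))) ≡ binomDF a (h ∘ suc)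
binomDF-∘suc a h = begin
  ∑[ k < suc (suc a) ] ((a C toℕ k) * (oddDF (toℕ k) * h (suc a ∸ toℕ k)))
    ≡⟨ sum-init-zero (suc a) (λ k → (a C k) * (oddDF k * h (suc a ∸ k)))
         (cong (_* (oddDF (suc a) * h (a ∸ a))) (k>n⇒nCk≡0 (n<1+n a))) ⟩
  ∑[ k < suc a ] ((a C toℕ k) * (oddDF (toℕ k) * h (suc a ∸ toℕ k)))
    ≡⟨ sum-cong-< (suc a) (λ k k<1+a → cong (λ z → (a C k) * (oddDF k * h z)) (+-∸-assoc 1 (s≤s⁻¹ k<1+a))) ⟩
  binomDF a (h ∘ suc) ∎

binomDF-split : ∀ a (h : ℕ → ℕ) →
  binomDF (suc a) h ≡ binomDF a (h ∘ suc) + ∑[ k < suc a ] ((a C toℕ k) * (oddDF (suc (toℕ k)) * h (a ∸ toℕ k)))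
binomDF-split a h = begin
  binomDF (suc a) h
    ≡⟨ sum-pascal a (suc a) (λ k → oddDF k * h (suc a ∸ k)) ⟩
  ∑[ k < suc (suc a) ] ((a C toℕ k) * (oddDF (toℕ k) * h (suc a ∸ toℕ k))) + Odd
    ≡⟨ cong (_+ Odd) (binomDF-∘suc a h) ⟩
  binomDF a (h ∘ suc) + Odd ∎
  where
  Odd : ℕ
  Odd = ∑[ k < suc a ] ((a C toℕ k) * (oddDF (suc (toℕ k)) * h (a ∸ toℕ k)))

binomDF-collect : ∀ x e (Z W : ℕ → ℕ) →
  binomDF (suc x) Z + e * binomDF x W
    ≡ ∑[ k < suc x ] ((x C toℕ k) * (oddDF (toℕ k) * Z (suc (x ∸ toℕ k)))
                      + (x C toℕ k) * (oddDF (suc (toℕ k)) * Z (x ∸ toℕ k))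
                      + e * ((x C toℕ k) * (oddDF (toℕ k) * W (x ∸ toℕ k))))
binomDF-collect x e Z W =
  trans (cong (_+ e * binomDF x W) (binomDF-split x Z))
        (∑-linear {suc x} e (λ k → (x C toℕ k) * (oddDF (toℕ k) * Z (suc (x ∸ toℕ k))))
                            (λ k → (x C toℕ k) * (oddDF (suc (toℕ k)) * Z (x ∸ toℕ k)))
                            (λ k → (x C toℕ k) * (oddDF (toℕ k) * W (x ∸ toℕ k))))

Balanced : ℕ → (ℕ → ℕ) → (ℕ → ℕ) → Set
Balanced α X Y = ∀ t → X (suc t) + (2 * t + α) * Y t ≡ Y (suc t) + suc (2 * t + α) * X t

Balanced-cong : ∀ {α} {X X′ Y Y′ : ℕ → ℕ} → (∀ t → X t ≡ X′ t) → (∀ t → Y t ≡ Y′ t) →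
                Balanced α X Y → Balanced α X′ Y′
Balanced-cong {α} {X} {X′} {Y} {Y′} X≗X′ Y≗Y′ balanced t = begin
  X′ (suc t) + (2 * t + α) * Y′ t
    ≡⟨ cong₂ (λ u v → u + (2 * t + α) * v) (X≗X′ (suc t)) (Y≗Y′ t) ⟨
  X (suc t) + (2 * t + α) * Y t
    ≡⟨ balanced t ⟩
  Y (suc t) + suc (2 * t + α) * X t
    ≡⟨ cong₂ (λ u v → u + suc (2 * t + α) * v) (Y≗Y′ (suc t)) (X≗X′ t) ⟩
  Y′ (suc t) + suc (2 * t + α) * X′ t ∎

Balanced-translate : ∀ {α} {X Y : ℕ → ℕ} y →
  Balanced α X Y → Balanced (2 * y + α) (λ t → X (t + y)) (λ t → Y (t + y))
Balanced-translate {α} {X} {Y} y balanced t =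
  subst (λ β → X (suc (t + y)) + β * Y (t + y) ≡ Y (suc (t + y)) + suc β * X (t + y))
        (regroup t y α) (balanced (t + y))
  where
  regroup : ∀ t y α → 2 * (t + y) + α ≡ 2 * t + (2 * y + α)
  regroup = solve-∀

-- In the summand of index k of binomDF x, with j = x - k, the coefficient 2x + α + 1 splits
-- as (2k + 1) + (2j + α): the first part pairs with (2k+1)!! = (2k+1) (2k-1)!!, the second is
-- the hypothesis at j.
balanced-summand : ∀ {k j x} c q α {X₀ X₁ Y₀ Y₁} → k + j ≡ x →
  X₁ + (2 * j + α) * Y₀ ≡ Y₁ + suc (2 * j + α) * X₀ →
  c * (q * X₁) + c * (suc (2 * k) * q * X₀) + (2 * x + suc α) * (c * (q * Y₀))
    ≡ c * (q * Y₁) + c * (suc (2 * k) * q * Y₀) + suc (2 * x + suc α) * (c * (q * X₀))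
balanced-summand {k} {j} c q α {X₀} {X₁} {Y₀} {Y₁} refl hyp = begin
  c * (q * X₁) + c * (suc (2 * k) * q * X₀) + (2 * (k + j) + suc α) * (c * (q * Y₀))
    ≡⟨ factorˡ c q k j α X₀ X₁ Y₀ ⟩
  c * q * (X₁ + (2 * j + α) * Y₀ + suc (2 * k) * (X₀ + Y₀))
    ≡⟨ cong (λ z → c * q * (z + suc (2 * k) * (X₀ + Y₀))) hyp ⟩
  c * q * (Y₁ + suc (2 * j + α) * X₀ + suc (2 * k) * (X₀ + Y₀))
    ≡⟨ factorʳ c q k j α X₀ Y₀ Y₁ ⟨
  c * (q * Y₁) + c * (suc (2 * k) * q * Y₀) + suc (2 * (k + j) + suc α) * (c * (q * X₀)) ∎
  where
  factorˡ : ∀ c q k j α X₀ X₁ Y₀ →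
    c * (q * X₁) + c * (suc (2 * k) * q * X₀) + (2 * (k + j) + suc α) * (c * (q * Y₀))
      ≡ c * q * (X₁ + (2 * j + α) * Y₀ + suc (2 * k) * (X₀ + Y₀))
  factorˡ = solve-∀
  factorʳ : ∀ c q k j α X₀ Y₀ Y₁ →
    c * (q * Y₁) + c * (suc (2 * k) * q * Y₀) + suc (2 * (k + j) + suc α) * (c * (q * X₀))
      ≡ c * q * (Y₁ + suc (2 * j + α) * X₀ + suc (2 * k) * (X₀ + Y₀))
  factorʳ = solve-∀

binomDF-balanced : ∀ {α} {X Y : ℕ → ℕ} → Balanced α X Y →
                   Balanced (suc α) (λ x → binomDF x X) (λ x → binomDF x Y)
binomDF-balanced {α} {X} {Y} balanced x = begin
  binomDF (suc x) X + (2 * x + suc α) * binomDF x Y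
    ≡⟨ binomDF-collect x (2 * x + suc α) X Y ⟩
  _ ≡⟨ sum-cong-< (suc x) summand ⟩
  _ ≡⟨ binomDF-collect x (suc (2 * x + suc α)) Y X ⟨
  binomDF (suc x) Y + suc (2 * x + suc α) * binomDF x X ∎
  where
  summand : ∀ k → k < suc x →
    (x C k) * (oddDF k * X (suc (x ∸ k))) + (x C k) * (oddDF (suc k) * X (x ∸ k))
      + (2 * x + suc α) * ((x C k) * (oddDF k * Y (x ∸ k)))
    ≡ (x C k) * (oddDF k * Y (suc (x ∸ k))) + (x C k) * (oddDF (suc k) * Y (x ∸ k))
      + suc (2 * x + suc α) * ((x C k) * (oddDF k * X (x ∸ k)))
  summand k k<1+x =
    balanced-summand {k} {x ∸ k} {x} (x C k) (oddDF k) α (m+[n∸m]≡n {k} {x} (s≤s⁻¹ k<1+x)) (balanced (x ∸ k))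

absorbed-summand : ∀ {x k} c₀ c₁ q H → suc x * c₀ + k * c₁ ≡ suc x * c₁ →
  c₁ * (suc (2 * k) * q * H) + (2 * x + 2) * (c₀ * (q * H)) ≡ suc (2 * x + 2) * (c₁ * (q * H))
absorbed-summand {x} {k} c₀ c₁ q H absorb = begin
  c₁ * (suc (2 * k) * q * H) + (2 * x + 2) * (c₀ * (q * H))
    ≡⟨ factorˡ x k c₀ c₁ q H ⟩
  q * H * c₁ + 2 * (q * H) * (suc x * c₀ + k * c₁)
    ≡⟨ cong (λ z → q * H * c₁ + 2 * (q * H) * z) absorb ⟩
  q * H * c₁ + 2 * (q * H) * (suc x * c₁)
    ≡⟨ factorʳ x c₁ q H ⟩
  suc (2 * x + 2) * (c₁ * (q * H)) ∎
  where
  factorˡ : ∀ x k c₀ c₁ q H → c₁ * (suc (2 * k) * q * H) + (2 * x + 2) * (c₀ * (q * H))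
                               ≡ q * H * c₁ + 2 * (q * H) * (suc x * c₀ + k * c₁)
  factorˡ = solve-∀
  factorʳ : ∀ x c₁ q H → q * H * c₁ + 2 * (q * H) * (suc x * c₁) ≡ suc (2 * x + 2) * (c₁ * (q * H))
  factorʳ = solve-∀

binomDF-shift-balanced : ∀ (h : ℕ → ℕ) → Balanced 2 (λ x → binomDF (suc x) h) (λ x → binomDF x (h ∘ suc))
binomDF-shift-balanced h x = begin
  binomDF (suc (suc x)) h + (2 * x + 2) * binomDF x (h ∘ suc)
    ≡⟨ cong (_+ (2 * x + 2) * binomDF x (h ∘ suc)) (binomDF-split (suc x) h) ⟩
  binomDF (suc x) (h ∘ suc) + Odd + (2 * x + 2) * binomDF x (h ∘ suc)
    ≡⟨ +-assoc (binomDF (suc x) (h ∘ suc)) Odd _ ⟩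
  binomDF (suc x) (h ∘ suc) + (Odd + (2 * x + 2) * binomDF x (h ∘ suc))
    ≡⟨ cong (_+_ (binomDF (suc x) (h ∘ suc))) absorbed ⟩
  binomDF (suc x) (h ∘ suc) + suc (2 * x + 2) * binomDF (suc x) h ∎
  where
  Odd′ Even : Vector ℕ (suc (suc x))
  Odd′ k = (suc x C toℕ k) * (oddDF (suc (toℕ k)) * h (suc x ∸ toℕ k))
  Even k = (x C toℕ k) * (oddDF (toℕ k) * h (suc x ∸ toℕ k))
  Odd : ℕ
  Odd = ∑[ k < suc (suc x) ] Odd′ k
  absorbed : Odd + (2 * x + 2) * binomDF x (h ∘ suc) ≡ suc (2 * x + 2) * binomDF (suc x) h
  absorbed = begin
    Odd + (2 * x + 2) * binomDF x (h ∘ suc)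
      ≡⟨ cong (λ z → Odd + (2 * x + 2) * z) (binomDF-∘suc x h) ⟨
    Odd + (2 * x + 2) * ∑[ k < suc (suc x) ] Even k
      ≡⟨ trans (cong (_+_ Odd) (*-distribˡ-sum (2 * x + 2) Even)) (sym (∑-distrib-+ Odd′ (λ k → (2 * x + 2) * Even k))) ⟩
    ∑[ k < suc (suc x) ] (Odd′ k + (2 * x + 2) * Even k)
      ≡⟨ sum-cong-≗ {suc (suc x)} (λ k →
           absorbed-summand {x} {toℕ k} (x C toℕ k) (suc x C toℕ k) (oddDF (toℕ k)) (h (suc x ∸ toℕ k))
             ([1+n]*nCk+k*[1+n]Ck≡[1+n]*[1+n]Ck x (toℕ k))) ⟩
    ∑[ k < suc (suc x) ] (suc (2 * x + 2) * ((suc x C toℕ k) * (oddDF (toℕ k) * h (suc x ∸ toℕ k))))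
      ≡⟨ *-distribˡ-sum {suc (suc x)} (suc (2 * x + 2)) (λ k → (suc x C toℕ k) * (oddDF (toℕ k) * h (suc x ∸ toℕ k))) ⟨
    suc (2 * x + 2) * binomDF (suc x) h ∎

-- Gap coordinates

-- fromGaps (μ_s ∷ μ_{s-1} ∸ μ_s ∷ … ∷ μ_1 ∸ μ_2) ≡ μ_1 ∷ … ∷ μ_s
fromGaps : List ℕ → List ℕ
fromGaps []      = []
fromGaps (b ∷ L) = map (_+_ b) (fromGaps L) ∷ʳ b

length-fromGaps : ∀ L → length (fromGaps L) ≡ length L
length-fromGaps []      = refl
length-fromGaps (b ∷ L) = begin
  length (map (_+_ b) (fromGaps L) ∷ʳ b)  ≡⟨ length-++ (map (_+_ b) (fromGaps L)) ⟩
  length (map (_+_ b) (fromGaps L)) + 1   ≡⟨ +-comm _ 1 ⟩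
  suc (length (map (_+_ b) (fromGaps L))) ≡⟨ cong suc (trans (length-map (_+_ b) (fromGaps L)) (length-fromGaps L)) ⟩
  suc (length L)                          ∎

map-fromGaps : ∀ b c L → map (_+_ b) (fromGaps (c ∷ L)) ≡ fromGaps ((b + c) ∷ L)
map-fromGaps b c L = begin
  map (_+_ b) (map (_+_ c) (fromGaps L) ∷ʳ c)       ≡⟨ map-++ (_+_ b) (map (_+_ c) (fromGaps L)) (c ∷ []) ⟩
  map (_+_ b) (map (_+_ c) (fromGaps L)) ∷ʳ (b + c) ≡⟨ cong (_∷ʳ (b + c)) (map-∘ (fromGaps L)) ⟨
  map (_+_ b ∘ _+_ c) (fromGaps L) ∷ʳ (b + c)       ≡⟨ cong (_∷ʳ (b + c)) (map-cong (λ x → sym (+-assoc b c x)) (fromGaps L)) ⟩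
  map (_+_ (b + c)) (fromGaps L) ∷ʳ (b + c)         ∎

fromGaps-∷ʳ : ∀ L g → fromGaps (L ∷ʳ g) ≡ (sum L + g) ∷ fromGaps L
fromGaps-∷ʳ []      g = refl
fromGaps-∷ʳ (b ∷ L) g = trans (cong (λ μ → map (_+_ b) μ ∷ʳ b) (fromGaps-∷ʳ L g))
                              (cong (_∷ fromGaps (b ∷ L)) (sym (+-assoc b (sum L) g)))

gaps : List ℕ → List ℕ
gaps []           = []
gaps (m ∷ [])     = m ∷ []
gaps (m ∷ m′ ∷ μ) = gaps (m′ ∷ μ) ∷ʳ (m ∸ m′)

sum-gaps : ∀ {m μ} → Linked _≥_ (m ∷ μ) → sum (gaps (m ∷ μ)) ≡ m
sum-gaps {m} {[]}     _             = +-identityʳ m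
sum-gaps {m} {m′ ∷ μ} (m≥m′ ∷ m′∷μ↓) = begin
  sum (gaps (m′ ∷ μ) ∷ʳ (m ∸ m′))     ≡⟨ sum-++ (gaps (m′ ∷ μ)) (m ∸ m′ ∷ []) ⟩
  sum (gaps (m′ ∷ μ)) + (m ∸ m′ + 0)  ≡⟨ cong₂ _+_ (sum-gaps m′∷μ↓) (+-identityʳ (m ∸ m′)) ⟩
  m′ + (m ∸ m′)                       ≡⟨ m+[n∸m]≡n m≥m′ ⟩
  m                                   ∎

fromGaps-gaps : ∀ {μ} → Linked _≥_ μ → fromGaps (gaps μ) ≡ μ
fromGaps-gaps []  = refl
fromGaps-gaps [-] = refl
fromGaps-gaps {m ∷ m′ ∷ μ} (m≥m′ ∷ m′∷μ↓) = begin
  fromGaps (gaps (m′ ∷ μ) ∷ʳ (m ∸ m′))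
    ≡⟨ fromGaps-∷ʳ (gaps (m′ ∷ μ)) (m ∸ m′) ⟩
  sum (gaps (m′ ∷ μ)) + (m ∸ m′) ∷ fromGaps (gaps (m′ ∷ μ))
    ≡⟨ cong₂ _∷_ (trans (cong (_+ (m ∸ m′)) (sum-gaps m′∷μ↓)) (m+[n∸m]≡n m≥m′)) (fromGaps-gaps m′∷μ↓) ⟩
  m ∷ m′ ∷ μ ∎

incAt : ℕ → List ℕ → List ℕ
incAt _       []      = []
incAt zero    (x ∷ L) = suc x ∷ L
incAt (suc q) (x ∷ L) = x ∷ incAt q L

length-incAt : ∀ q L → length (incAt q L) ≡ length L
length-incAt _       []      = refl
length-incAt zero    (x ∷ L) = refl
length-incAt (suc q) (x ∷ L) = cong suc (length-incAt q L)

take-incAt : ∀ q L → take q (incAt q L) ≡ take q L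
take-incAt zero    L       = refl
take-incAt (suc q) []      = refl
take-incAt (suc q) (x ∷ L) = cong (x ∷_) (take-incAt q L)

incAt-comm : ∀ q r L → incAt q (incAt r L) ≡ incAt r (incAt q L)
incAt-comm _       _       []      = refl
incAt-comm zero    zero    (x ∷ L) = refl
incAt-comm zero    (suc r) (x ∷ L) = refl
incAt-comm (suc q) zero    (x ∷ L) = refl
incAt-comm (suc q) (suc r) (x ∷ L) = cong (x ∷_) (incAt-comm q r L)

incAt-preimage : ∀ q L → sum (take q L) < sum (take (suc q) L) → ∃ λ M → L ≡ incAt q M
incAt-preimage zero    (suc x ∷ L) _ = x ∷ L , refl
incAt-preimage (suc q) (x ∷ L) lt with incAt-preimage q L (+-cancelˡ-< x _ _ lt)
... | M , refl = x ∷ M , refl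

dropZeros : List ℕ → List ℕ
dropZeros []          = []
dropZeros (zero ∷ L)  = dropZeros L
dropZeros (suc b ∷ L) = suc b ∷ L

length-dropZeros : ∀ L → length (dropZeros L) ≤ length L
length-dropZeros []          = z≤n
length-dropZeros (zero ∷ L)  = m≤n⇒m≤1+n (length-dropZeros L)
length-dropZeros (suc b ∷ L) = ≤-refl

≢0? : (x : ℕ) → Dec (¬ x ≡ 0)
≢0? x = ¬? (x ≟ 0)

filter-fromGaps : ∀ L → filter ≢0? (fromGaps L) ≡ fromGaps (dropZeros L)
filter-fromGaps []          = refl
filter-fromGaps (zero ∷ L)  = begin
  filter ≢0? (map (_+_ 0) (fromGaps L) ∷ʳ 0)   ≡⟨ filter-++ ≢0? (map (_+_ 0) (fromGaps L)) (0 ∷ []) ⟩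
  filter ≢0? (map (_+_ 0) (fromGaps L)) ++ []  ≡⟨ ++-identityʳ _ ⟩
  filter ≢0? (map (_+_ 0) (fromGaps L))        ≡⟨ cong (filter ≢0?) (map-id (fromGaps L)) ⟩
  filter ≢0? (fromGaps L)                      ≡⟨ filter-fromGaps L ⟩
  fromGaps (dropZeros L)                       ∎
filter-fromGaps (suc b ∷ L) = filter-all ≢0? (∷ʳ⁺ (map⁺ (universal (λ _ ()) (fromGaps L))) λ ())

minusHat-fromGaps : ∀ {k x} L → k ≤ x → minusHat k (fromGaps (x ∷ L)) ≡ fromGaps (dropZeros ((x ∸ k) ∷ L))
minusHat-fromGaps {k} {x} L k≤x = begin
  filter ≢0? (map (_∸ k) (map (_+_ x) (fromGaps L) ∷ʳ x))
    ≡⟨ cong (filter ≢0?) (map-++ (_∸ k) (map (_+_ x) (fromGaps L)) (x ∷ [])) ⟩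
  filter ≢0? (map (_∸ k) (map (_+_ x) (fromGaps L)) ∷ʳ (x ∸ k))
    ≡⟨ cong (λ ys → filter ≢0? (ys ∷ʳ (x ∸ k)))
            (trans (sym (map-∘ (fromGaps L))) (map-cong (λ y → +-∸-comm y k≤x) (fromGaps L))) ⟩
  filter ≢0? (fromGaps ((x ∸ k) ∷ L))
    ≡⟨ filter-fromGaps ((x ∸ k) ∷ L) ⟩
  fromGaps (dropZeros ((x ∸ k) ∷ L)) ∎

-- f in gap coordinates

fFrom : ℕ → List ℕ → ℕ
fFrom x []      = d x
fFrom x (c ∷ L) = binomDF x (λ t → fFrom (t + c) L)

fGaps : List ℕ → ℕ
fGaps []      = 1
fGaps (x ∷ L) = fFrom x L

fGaps-zero : ∀ L → fGaps (0 ∷ L) ≡ fGaps L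
fGaps-zero []      = refl
fGaps-zero (c ∷ L) = trans (+-identityʳ _) (trans (*-identityˡ _) (*-identityˡ (fFrom c L)))

fGaps-dropZeros : ∀ L → fGaps (dropZeros L) ≡ fGaps L
fGaps-dropZeros []          = refl
fGaps-dropZeros (zero ∷ L)  = trans (fGaps-dropZeros L) (sym (fGaps-zero L))
fGaps-dropZeros (suc b ∷ L) = refl

lastOf-∷ʳ : ∀ x ys b → lastOf x (ys ∷ʳ b) ≡ b
lastOf-∷ʳ x []       b = refl
lastOf-∷ʳ x (y ∷ ys) b = lastOf-∷ʳ y ys b

initOf-∷ʳ : ∀ x ys b → initOf x (ys ∷ʳ b) ≡ x ∷ ys
initOf-∷ʳ x []       b = refl
initOf-∷ʳ x (y ∷ ys) b = cong (x ∷_) (initOf-∷ʳ y ys b)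

fAux-∷ʳ : ∀ fuel ys y b → fAux (suc fuel) (ys ∷ʳ y ∷ʳ b)
  ≡ fAux fuel (ys ∷ʳ y) + sum (map (λ j → (b C suc j) * oddDF (suc j) * fAux fuel (minusHat (suc j) (ys ∷ʳ y))) (upTo b))
fAux-∷ʳ fuel []       y b = refl
fAux-∷ʳ fuel (x ∷ xs) y b = unfold x (xs ∷ʳ y)
  where
  unfold : ∀ x zs → fAux (suc fuel) (x ∷ zs ∷ʳ b)
    ≡ fAux fuel (x ∷ zs) + sum (map (λ j → (b C suc j) * oddDF (suc j) * fAux fuel (minusHat (suc j) (x ∷ zs))) (upTo b))
  unfold x []       = refl
  unfold x (z ∷ zs) rewrite lastOf-∷ʳ z zs b | initOf-∷ʳ z zs b = refl

fAux-fromGaps : ∀ fuel L → length L ≤ suc fuel → fAux fuel (fromGaps L) ≡ fGaps L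
fAux-fromGaps fuel       []          _              = refl
fAux-fromGaps fuel       (b ∷ [])    _              = refl
fAux-fromGaps (suc fuel) (b ∷ c ∷ L) (s≤s |L|≤fuel) = begin
  fAux (suc fuel) (map (_+_ b) (fromGaps (c ∷ L)) ∷ʳ b)
    ≡⟨ cong (λ μ → fAux (suc fuel) (μ ∷ʳ b)) (map-fromGaps b c L) ⟩
  fAux (suc fuel) (fromGaps ((b + c) ∷ L) ∷ʳ b)
    ≡⟨ fAux-∷ʳ fuel (map (_+_ (b + c)) (fromGaps L)) (b + c) b ⟩
  fAux fuel (fromGaps ((b + c) ∷ L))
    + sum (map (λ j → (b C suc j) * oddDF (suc j) * fAux fuel (minusHat (suc j) (fromGaps ((b + c) ∷ L)))) (upTo b))
    ≡⟨ cong₂ _+_ (fAux-fromGaps fuel ((b + c) ∷ L) |L|≤fuel) (trans (sum-map-upTo b _) (sum-cong-< b summand)) ⟩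
  fFrom (b + c) L + Rest
    ≡⟨ cong (_+ Rest) (trans (*-identityˡ _) (*-identityˡ (fFrom (b + c) L))) ⟨
  fGaps (b ∷ c ∷ L) ∎
  where
  Rest : ℕ
  Rest = ∑[ j < b ] ((b C suc (toℕ j)) * (oddDF (suc (toℕ j)) * fFrom (b ∸ suc (toℕ j) + c) L))
  f-minusHat : ∀ j → j < b → fAux fuel (minusHat (suc j) (fromGaps ((b + c) ∷ L))) ≡ fFrom (b ∸ suc j + c) L
  f-minusHat j j<b = begin
    fAux fuel (minusHat (suc j) (fromGaps ((b + c) ∷ L)))
      ≡⟨ cong (fAux fuel) (minusHat-fromGaps L (≤-trans j<b (m≤m+n b c))) ⟩
    fAux fuel (fromGaps (dropZeros ((b + c ∸ suc j) ∷ L)))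
      ≡⟨ fAux-fromGaps fuel (dropZeros ((b + c ∸ suc j) ∷ L)) (≤-trans (length-dropZeros ((b + c ∸ suc j) ∷ L)) |L|≤fuel) ⟩
    fGaps (dropZeros ((b + c ∸ suc j) ∷ L))
      ≡⟨ fGaps-dropZeros ((b + c ∸ suc j) ∷ L) ⟩
    fFrom (b + c ∸ suc j) L
      ≡⟨ cong (λ v → fFrom v L) (+-∸-comm c j<b) ⟩
    fFrom (b ∸ suc j + c) L ∎
  summand : ∀ j → j < b →
    (b C suc j) * oddDF (suc j) * fAux fuel (minusHat (suc j) (fromGaps ((b + c) ∷ L)))
      ≡ (b C suc j) * (oddDF (suc j) * fFrom (b ∸ suc j + c) L)
  summand j j<b = trans (*-assoc (b C suc j) (oddDF (suc j)) _)
                        (cong (λ z → (b C suc j) * (oddDF (suc j) * z)) (f-minusHat j j<b))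

f-fromGaps : ∀ L → f (fromGaps L) ≡ fGaps L
f-fromGaps L = fAux-fromGaps (length (fromGaps L)) L (m≤n⇒m≤1+n (≤-reflexive (sym (length-fromGaps L))))

f-minusHat-fromGaps : ∀ L → f (minusHat 1 (fromGaps (incAt 0 L))) ≡ fGaps L
f-minusHat-fromGaps []      = refl
f-minusHat-fromGaps (x ∷ M) = begin
  f (minusHat 1 (fromGaps (suc x ∷ M))) ≡⟨ cong f (minusHat-fromGaps M (s≤s z≤n)) ⟩
  f (fromGaps (dropZeros (x ∷ M)))      ≡⟨ f-fromGaps (dropZeros (x ∷ M)) ⟩
  fGaps (dropZeros (x ∷ M))             ≡⟨ fGaps-dropZeros (x ∷ M) ⟩
  fGaps (x ∷ M)                         ∎

fFrom-incAt : ∀ q t y r → fFrom t (incAt q (y ∷ r)) ≡ binomDF t (λ u → fGaps (incAt q ((u + y) ∷ r)))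
fFrom-incAt zero    t y r = binomDF-cong t (λ u → cong (λ v → fFrom v r) (+-suc u y))
fFrom-incAt (suc q) t y r = refl

fGaps-balanced : ∀ p M → p < length M →
  Balanced (2 * sum (take p M) + 2 + p) (λ t → fGaps (incAt p (t ∷ M))) (λ t → fGaps (t ∷ incAt p M))
fGaps-balanced zero    (y ∷ r) _ =
  Balanced-cong (λ _ → refl) (λ t → sym (fFrom-incAt 0 t y r)) (binomDF-shift-balanced (λ u → fFrom (u + y) r))
fGaps-balanced (suc p) (y ∷ r) (s≤s p<|r|) =
  subst (λ α → Balanced α (λ t → fGaps (incAt (suc p) (t ∷ y ∷ r))) (λ t → fGaps (t ∷ incAt (suc p) (y ∷ r))))
        (regroup y (sum (take p r)) p)
    (Balanced-cong (λ t → sym (fFrom-incAt p t y r)) (λ _ → refl)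
      (binomDF-balanced (Balanced-translate y (fGaps-balanced p r p<|r|))))
  where
  regroup : ∀ y σ p → suc (2 * y + (2 * σ + 2 + p)) ≡ 2 * (y + σ) + 2 + suc p
  regroup = solve-∀

-- Parts and bumps in gap coordinates

part-beyond : ∀ {i} xs → length xs < i → part xs i ≡ 0
part-beyond {suc zero}    []       _ = refl
part-beyond {suc (suc i)} []       _ = refl
part-beyond {suc zero}    (x ∷ xs) (s≤s ())
part-beyond {suc (suc i)} (x ∷ xs) (s≤s |xs|<1+i) = part-beyond xs |xs|<1+i

part-map-∷ʳ : ∀ {i} b ys → 1 ≤ i → i ≤ suc (length ys) → part (map (_+_ b) ys ∷ʳ b) i ≡ b + part ys i
part-map-∷ʳ {suc zero}    b []       _ _ = sym (+-identityʳ b)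
part-map-∷ʳ {suc zero}    b (y ∷ ys) _ _ = refl
part-map-∷ʳ {suc (suc i)} b (y ∷ ys) _ (s≤s i<) = part-map-∷ʳ b ys (s≤s z≤n) i<

part-fromGaps : ∀ p L → p < length L → part (fromGaps L) (length L ∸ p) ≡ sum (take (suc p) L)
part-fromGaps zero (b ∷ L) _ = begin
  part (fromGaps (b ∷ L)) (suc (length L))
    ≡⟨ part-map-∷ʳ b (fromGaps L) (s≤s z≤n) (s≤s (≤-reflexive (sym (length-fromGaps L)))) ⟩
  b + part (fromGaps L) (suc (length L))
    ≡⟨ cong (_+_ b) (part-beyond (fromGaps L) (s≤s (≤-reflexive (length-fromGaps L)))) ⟩
  b + 0 ∎
part-fromGaps (suc p) (b ∷ L) (s≤s p<|L|) = begin
  part (fromGaps (b ∷ L)) (length L ∸ p)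
    ≡⟨ part-map-∷ʳ b (fromGaps L) (m<n⇒0<n∸m p<|L|) (m≤n⇒m≤1+n (≤-trans (m∸n≤m _ p) (≤-reflexive (sym (length-fromGaps L))))) ⟩
  b + part (fromGaps L) (length L ∸ p)
    ≡⟨ cong (_+_ b) (part-fromGaps p L p<|L|) ⟩
  b + sum (take (suc p) L) ∎

bump-last : ∀ xs b → bump (suc (length xs)) (xs ∷ʳ b) ≡ xs ∷ʳ suc b
bump-last []           b = refl
bump-last (x ∷ [])     b = refl
bump-last (x ∷ y ∷ xs) b = cong (x ∷_) (bump-last (y ∷ xs) b)

bump-map-∷ʳ : ∀ {i} b ys → i ≤ length ys → bump i (map (_+_ b) ys ∷ʳ b) ≡ map (_+_ b) (bump i ys) ∷ʳ b
bump-map-∷ʳ {zero}        b []       _ = refl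
bump-map-∷ʳ {zero}        b (y ∷ ys) _ = refl
bump-map-∷ʳ {suc zero}    b (y ∷ ys) _ = cong (_∷ (map (_+_ b) ys ∷ʳ b)) (sym (+-suc b y))
bump-map-∷ʳ {suc (suc i)} b (y ∷ ys) (s≤s i<|ys|) = cong (b + y ∷_) (bump-map-∷ʳ b ys i<|ys|)

bump-fromGaps : ∀ p L → suc p < length L → bump (length L ∸ p) (fromGaps (incAt (suc p) L)) ≡ fromGaps (incAt p L)
bump-fromGaps zero (b ∷ y ∷ r) _ = begin
  bump (suc (suc (length r))) (map (_+_ b) (fromGaps (suc y ∷ r)) ∷ʳ b)
    ≡⟨ cong (λ n → bump (suc n) (map (_+_ b) (fromGaps (suc y ∷ r)) ∷ʳ b))
            (trans (length-map (_+_ b) (fromGaps (suc y ∷ r))) (length-fromGaps (suc y ∷ r))) ⟨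
  bump (suc (length (map (_+_ b) (fromGaps (suc y ∷ r))))) (map (_+_ b) (fromGaps (suc y ∷ r)) ∷ʳ b)
    ≡⟨ bump-last (map (_+_ b) (fromGaps (suc y ∷ r))) b ⟩
  map (_+_ b) (fromGaps (suc y ∷ r)) ∷ʳ suc b
    ≡⟨ cong (_∷ʳ suc b) (begin
         map (_+_ b) (fromGaps (suc y ∷ r))     ≡⟨ map-fromGaps b (suc y) r ⟩
         fromGaps (b + suc y ∷ r)               ≡⟨ cong (λ v → fromGaps (v ∷ r)) (+-suc b y) ⟩
         fromGaps (suc b + y ∷ r)               ≡⟨ map-fromGaps (suc b) y r ⟨
         map (_+_ (suc b)) (fromGaps (y ∷ r))   ∎) ⟩
  map (_+_ (suc b)) (fromGaps (y ∷ r)) ∷ʳ suc b ∎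
bump-fromGaps zero (b ∷ []) (s≤s ())
bump-fromGaps (suc p) (b ∷ L) (s≤s 1+p<|L|) = begin
  bump (length L ∸ p) (map (_+_ b) (fromGaps (incAt (suc p) L)) ∷ʳ b)
    ≡⟨ bump-map-∷ʳ b (fromGaps (incAt (suc p) L)) i≤ ⟩
  map (_+_ b) (bump (length L ∸ p) (fromGaps (incAt (suc p) L))) ∷ʳ b
    ≡⟨ cong (λ μ → map (_+_ b) μ ∷ʳ b) (bump-fromGaps p L 1+p<|L|) ⟩
  map (_+_ b) (fromGaps (incAt p L)) ∷ʳ b ∎
  where
  i≤ : length L ∸ p ≤ length (fromGaps (incAt (suc p) L))
  i≤ = ≤-trans (m∸n≤m (length L) p)
         (≤-reflexive (sym (trans (length-fromGaps (incAt (suc p) L)) (length-incAt (suc p) L))))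

BumpIdentity : List ℕ → ℕ → ℕ → Set
BumpIdentity μ i q = (+ f (bump i μ)) - (+ f μ)
  ≡ (+ (2 * part μ i + q + 1)) *ℤ (+ f (minusHat 1 (bump i μ))) - (+ (2 * part μ i + q)) *ℤ (+ f (minusHat 1 μ))

difference-from-balance : ∀ {a b c d} k → a + k * b ≡ c + (k + 1) * d →
                          (+ a) - (+ c) ≡ (+ (k + 1)) *ℤ (+ d) - (+ k) *ℤ (+ b)
difference-from-balance {a} {b} {c} {d} k balance = begin
  (+ a) - (+ c)                              ≡⟨ [+m]-[+n]≡m⊖n a c ⟩
  a ⊖ c                                      ≡⟨ +-cancelˡ-⊖ (k * b) a c ⟨
  (k * b + a) ⊖ (k * b + c)                  ≡⟨ cong₂ _⊖_ (+-comm (k * b) a) (+-comm (k * b) c) ⟩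
  (a + k * b) ⊖ (c + k * b)                  ≡⟨ cong (_⊖ (c + k * b)) balance ⟩
  (c + (k + 1) * d) ⊖ (c + k * b)            ≡⟨ +-cancelˡ-⊖ c ((k + 1) * d) (k * b) ⟩
  ((k + 1) * d) ⊖ (k * b)                    ≡⟨ [+m]-[+n]≡m⊖n ((k + 1) * d) (k * b) ⟨
  (+ ((k + 1) * d)) - (+ (k * b))            ≡⟨ cong₂ _-_ (pos-* (k + 1) d) (pos-* k b) ⟩
  (+ (k + 1)) *ℤ (+ d) - (+ k) *ℤ (+ b)      ∎

bump-identity-incAt : ∀ p x M → p < length M → BumpIdentity (fromGaps (suc x ∷ incAt p M)) (suc (length M) ∸ p) p
bump-identity-incAt p x M p<|M| = difference-from-balance K (begin
  f (bump i μ) + K * f (minusHat 1 μ)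
    ≡⟨ cong₂ _+_ f-bump (cong₂ _*_ K≡ (f-minusHat-fromGaps (x ∷ incAt p M))) ⟩
  fGaps (incAt p (suc x ∷ M)) + (2 * x + α) * fGaps (x ∷ incAt p M)
    ≡⟨ fGaps-balanced p M p<|M| x ⟩
  fGaps (suc x ∷ incAt p M) + suc (2 * x + α) * fGaps (incAt p (x ∷ M))
    ≡⟨ cong₂ _+_ (f-fromGaps (suc x ∷ incAt p M)) (cong₂ _*_ (trans (cong (_+ 1) K≡) (+-comm _ 1)) f-minusHat-bump) ⟨
  f μ + (K + 1) * f (minusHat 1 (bump i μ)) ∎)
  where
  μ : List ℕ
  μ = fromGaps (suc x ∷ incAt p M)
  i K α : ℕ
  i = suc (length M) ∸ p
  K = 2 * part μ i + p
  α = 2 * sum (take p M) + 2 + p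
  bump≡ : bump i μ ≡ fromGaps (incAt p (suc x ∷ M))
  bump≡ = bump-fromGaps p (suc x ∷ M) (s≤s p<|M|)
  f-bump : f (bump i μ) ≡ fGaps (incAt p (suc x ∷ M))
  f-bump = trans (cong f bump≡) (f-fromGaps (incAt p (suc x ∷ M)))
  f-minusHat-bump : f (minusHat 1 (bump i μ)) ≡ fGaps (incAt p (x ∷ M))
  f-minusHat-bump = begin
    f (minusHat 1 (bump i μ))                         ≡⟨ cong (f ∘ minusHat 1) bump≡ ⟩
    f (minusHat 1 (fromGaps (incAt p (incAt 0 (x ∷ M))))) ≡⟨ cong (f ∘ minusHat 1 ∘ fromGaps) (incAt-comm p 0 (x ∷ M)) ⟩
    f (minusHat 1 (fromGaps (incAt 0 (incAt p (x ∷ M))))) ≡⟨ f-minusHat-fromGaps (incAt p (x ∷ M)) ⟩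
    fGaps (incAt p (x ∷ M))                           ∎
  part≡ : part μ i ≡ suc x + sum (take p M)
  part≡ = begin
    part μ (suc (length M) ∸ p)             ≡⟨ cong (λ n → part μ (suc n ∸ p)) (length-incAt p M) ⟨
    part μ (suc (length (incAt p M)) ∸ p)   ≡⟨ part-fromGaps p (suc x ∷ incAt p M) (s≤s (≤-trans (<⇒≤ p<|M|) (≤-reflexive (sym (length-incAt p M))))) ⟩
    suc x + sum (take p (incAt p M))        ≡⟨ cong (λ l → suc x + sum l) (take-incAt p M) ⟩
    suc x + sum (take p M)                  ∎
  K≡ : K ≡ 2 * x + α
  K≡ = trans (cong (λ m → 2 * m + p) part≡) (regroup x (sum (take p M)) p)
    where
    regroup : ∀ x σ p → 2 * (suc x + σ) + p ≡ 2 * x + (2 * σ + 2 + p)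
    regroup = solve-∀

bump-identity-fromGaps : ∀ p L → suc p < length L → All (λ x → x > 0) (fromGaps L) →
  part (fromGaps L) (length L ∸ p) < part (fromGaps L) (length L ∸ suc p) → BumpIdentity (fromGaps L) (length L ∸ p) p
-- The smallest part b and the gap μ_{i-1} - μ_i are positive, so L = suc x ∷ incAt p M.
bump-identity-fromGaps p (b ∷ L) (s≤s 1+p≤|L|) parts>0 μᵢ<μᵢ₋₁
  with ++⁻ʳ (map (_+_ b) (fromGaps L)) parts>0
     | incAt-preimage p L (+-cancelˡ-< b _ _
         (subst₂ _<_ (part-fromGaps p (b ∷ L) (s≤s (<⇒≤ 1+p≤|L|))) (part-fromGaps (suc p) (b ∷ L) (s≤s 1+p≤|L|)) μᵢ<μᵢ₋₁))
... | s≤s z≤n ∷ [] | M , refl =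
  subst (λ n → BumpIdentity (fromGaps (b ∷ incAt p M)) (suc n ∸ p) p) (sym (length-incAt p M))
        (bump-identity-incAt p _ M (≤-trans 1+p≤|L| (≤-reflexive (length-incAt p M))))

bump-identity : ∀ {i s} L → 2 ≤ i → i ≤ s → length L ≡ s → All (λ x → x > 0) (fromGaps L) →
  part (fromGaps L) i < part (fromGaps L) (i ∸ 1) → BumpIdentity (fromGaps L) i (s ∸ i)
bump-identity {i} {s} L 2≤i i≤s |L|≡s parts>0 μᵢ<μᵢ₋₁ =
  subst (λ j → BumpIdentity (fromGaps L) j p) i≡
    (bump-identity-fromGaps p L 1+p<|L| parts>0
      (subst₂ (λ j j′ → part (fromGaps L) j < part (fromGaps L) j′) (sym i≡) (sym i-1≡) μᵢ<μᵢ₋₁))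
  where
  p : ℕ
  p = s ∸ i
  i≡ : length L ∸ p ≡ i
  i≡ = trans (cong (_∸ p) |L|≡s) (m∸[m∸n]≡n i≤s)
  i-1≡ : length L ∸ suc p ≡ i ∸ 1
  i-1≡ = trans (cong (length L ∸_) (+-comm 1 p)) (trans (sym (∸-+-assoc (length L) p 1)) (cong (_∸ 1) i≡))
  1+p<|L| : suc p < length L
  1+p<|L| = ≤-trans (+-monoˡ-≤ p 2≤i) (≤-reflexive (trans (+-comm i p) (trans (m∸n+n≡m i≤s) (sym |L|≡s))))

proposition2p3 : (n s i : ℕ) (μ : List ℕ) → 2 ≤ s → 2 ≤ i → i ≤ s →
    μ ⊢ n → length μ ≡ s → part μ i < part μ (i ∸ 1) →
    (+ f (bump i μ)) - (+ f μ)
      ≡ (+ (2 * part μ i + (s ∸ i) + 1)) *ℤ (+ f (minusHat 1 (bump i μ)))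
        - (+ (2 * part μ i + (s ∸ i))) *ℤ (+ f (minusHat 1 μ))
proposition2p3 n s i μ _ 2≤i i≤s ((parts>0 , μ↓) , _) |μ|≡s μᵢ<μᵢ₋₁ with gaps μ | fromGaps-gaps μ↓
... | L | refl = bump-identity L 2≤i i≤s (trans (sym (length-fromGaps L)) |μ|≡s) parts>0 μᵢ<μᵢ₋₁
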